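{- Let $G$ be an $n$-vertex disk graph with $\alpha(G)=cn$ for some $c>0$. For any two maximum independent sets $I_1,I_2$ of $G$, $e(G[I_1\triangle I_2])\le 5|I_1\triangle I_2|$.
   Context: A disk graph is the intersection graph of a finite family of disks in the plane. $\alpha(G)$ is the independence number, $I_1\triangle I_2$ the symmetric difference, and $e(G[X])$ the number of edges of the subgraph induced on $X$.
   Formalization: The disks defining the disk graph G have rational centres and rational radii. -}

module Defs where

open import Data.Nat as ℕ using (ℕ)
open import Data.Fin using (Fin; toℕ)
open import Data.Fin.Subset using (Subset; _∈_; _∉_; _∪_; _─_; ∣_∣)
open import Data.Fin.Subset.Properties using (_∈?_)
open import Data.Rational using (ℚ; _+_; _-_; _*_; _≤_; Positive)
open import Data.Rational.Properties using (_≤?_)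
open import Data.List using (List; map)
open import Data.Nat.ListAction using (sum)
open import Data.List using (allFin)
open import Data.Product using (_×_; Σ; _,_; ∃)
open import Relation.Nullary using (¬_; Dec; yes; no)
open import Relation.Binary.PropositionalEquality using (_≡_; _≢_)

-- A closed disk in the plane: centre (x , y) and radius r > 0.
-- Coordinates are rational (every finite disk graph is
-- realisable with rational centres and radii).
record Disk : Set where
  constructor disk
  field
    cx : ℚ
    cy : ℚ
    r  : ℚ
    .{{r-pos}} : Positive r

open Disk public

sq : ℚ → ℚ
sq a = a * a

-- Two closed disks intersect iff the distance between centres is at most
-- the sum of the radii (compared after squaring, both sides nonnegative).
Intersect : Disk → Disk → Set
Intersect D E = sq (cx D - cx E) + sq (cy D - cy E) ≤ sq (r D + r E)

intersect? : (D E : Disk) → Dec (Intersect D E)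
intersect? D E = (sq (cx D - cx E) + sq (cy D - cy E)) ≤? sq (r D + r E)

Adj : ∀ {n} → (Fin n → Disk) → Fin n → Fin n → Set
Adj D i j = (i ≢ j) × Intersect (D i) (D j)

Independent : ∀ {n} → (Fin n → Disk) → Subset n → Set
Independent D I = ∀ i j → i ∈ I → j ∈ I → ¬ Adj D i j

MaximumIndependent : ∀ {n} → (Fin n → Disk) → Subset n → Set
MaximumIndependent D I =
  Independent D I × (∀ J → Independent D J → ∣ J ∣ ℕ.≤ ∣ I ∣)

IndependenceNumber : ∀ {n} → (Fin n → Disk) → ℕ → Set
IndependenceNumber D k = ∃ λ I → MaximumIndependent D I × ∣ I ∣ ≡ k

_△_ : ∀ {n} → Subset n → Subset n → Subset n
A △ B = (A ─ B) ∪ (B ─ A)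

edgeInd : ∀ {n} → (Fin n → Disk) → Subset n → Fin n → Fin n → ℕ
edgeInd D X i j with toℕ i ℕ.<? toℕ j | i ∈? X | j ∈? X | intersect? (D i) (D j)
... | yes _ | yes _ | yes _ | yes _ = 1
... | _     | _     | _     | _     = 0

edgesInduced : ∀ {n} → (Fin n → Disk) → Subset n → ℕ
edgesInduced {n} D X = sum (map (λ i → sum (map (λ j → edgeInd D X i j) (allFin n))) (allFin n))

module Submission where

-- Both I₁ and I₂ are independent, so every edge of G[I₁ △ I₂] joins I₁ ∖ I₂ to I₂ ∖ I₁.  Charge
-- each edge to an endpoint whose disk has the smaller radius.  At most five edges are charged to a
-- vertex i: their other endpoints lie in the independent set not containing i, so their disks are
-- pairwise disjoint, meet the disk of i and are at least as large.  Seen from the centre cᵢ, two of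
-- their centres c, c′ with |c − cᵢ| ≤ |c′ − cᵢ| are more than 60° apart, since otherwise
-- |c − c′| ≤ |c′ − cᵢ| ≤ rᵢ + r′ ≤ r + r′ and the two disks would meet.

open import Defs

module Geometry where
  open import Data.Empty using (⊥)
  open import Data.Fin using (Fin; suc) renaming (_<_ to _<ᶠ_)
  open import Data.Fin.Patterns using (0F; 1F; 2F; 3F)
  open import Data.Fin.Properties using (pigeonhole; suc-injective) renaming (<⇒≢ to <ᶠ⇒≢)
  open import Data.Integer using (+_)
  open import Data.List using (_∷_; [])
  open import Data.Nat.Properties using (n<1+n)
  open import Data.Product using (_×_; _,_; ∃; ∃₂; proj₁; proj₂)
  open import Data.Rational using (ℚ; 0ℚ; _+_; _-_; -_; _*_; _/_; _≤_; _<_; _≤?_; _<?_; positive; negative; nonNegative; nonPositive)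
  open import Data.Rational.Properties
  open import Data.Sum using (_⊎_; inj₁; inj₂)
  open import Function using (_∘_)
  open import Level using (0ℓ)
  open import Relation.Binary.Definitions using (tri<; tri≈; tri>)
  open import Relation.Binary.PropositionalEquality using (_≡_; _≢_; refl; sym; trans; cong; cong₂; subst; subst₂)
  open import Relation.Nullary using (¬_; yes; no; contradiction)
  open import Relation.Nullary.Decidable using (dec⇒maybe)
  open import Tactic.RingSolver using (solve)
  open import Tactic.RingSolver.Core.AlmostCommutativeRing using (AlmostCommutativeRing; fromCommutativeRing)

  -- The reflective solver treats sq, _∙_, ∥_∥² … as opaque constants, so every identity it proves
  -- is first restated with _+_, _-_ and _*_ only.
  ℚ-ring : AlmostCommutativeRing 0ℓ 0ℓ
  ℚ-ring = fromCommutativeRing +-*-commutativeRing (dec⇒maybe ∘ (0ℚ ≟_))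

  3ℚ 8ℚ : ℚ
  3ℚ = + 3 / 1
  8ℚ = + 8 / 1

  ≤-by-gap : ∀ {p q} d → 0ℚ ≤ d → p + d ≡ q → p ≤ q
  ≤-by-gap {p} d 0≤d refl = subst (_≤ p + d) (+-identityʳ p) (+-monoʳ-≤ p 0≤d)

  p≤q⇒0≤q-p : ∀ {p q} → p ≤ q → 0ℚ ≤ q - p
  p≤q⇒0≤q-p {p} {q} p≤q = subst (_≤ q - p) (+-inverseʳ p) (+-monoˡ-≤ (- p) p≤q)

  p≤q⇒p-q≤0 : ∀ {p q} → p ≤ q → p - q ≤ 0ℚ
  p≤q⇒p-q≤0 {p} {q} p≤q = subst (p - q ≤_) (+-inverseʳ q) (+-monoˡ-≤ (- q) p≤q)

  -p≤q⇒0≤q+p : ∀ {p q} → - p ≤ q → 0ℚ ≤ q + p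
  -p≤q⇒0≤q+p {p} {q} -p≤q = subst (0ℚ ≤_) q--p≡q+p (p≤q⇒0≤q-p -p≤q)
    where
    q--p≡q+p : q - - p ≡ q + p
    q--p≡q+p = solve (p ∷ q ∷ []) ℚ-ring

  0≤+ : ∀ {p q} → 0ℚ ≤ p → 0ℚ ≤ q → 0ℚ ≤ p + q
  0≤+ = +-mono-≤

  0≤* : ∀ {p q} → 0ℚ ≤ p → 0ℚ ≤ q → 0ℚ ≤ p * q
  0≤* {p} {q} 0≤p 0≤q = nonNegative⁻¹ (p * q) {{nonNeg*nonNeg⇒nonNeg p {{nonNegative 0≤p}} q {{nonNegative 0≤q}}}}

  0≤*-nonPos : ∀ {p q} → p ≤ 0ℚ → q ≤ 0ℚ → 0ℚ ≤ p * q
  0≤*-nonPos {p} {q} p≤0 q≤0 =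
    nonNegative⁻¹ (p * q) {{nonPos*nonPos⇒nonPos p {{nonPositive p≤0}} q {{nonPositive q≤0}}}}

  0<* : ∀ {p q} → 0ℚ < p → 0ℚ < q → 0ℚ < p * q
  0<* {p} {q} 0<p 0<q = positive⁻¹ (p * q) {{pos*pos⇒pos p {{positive 0<p}} q {{positive 0<q}}}}

  0<*-neg : ∀ {p q} → p < 0ℚ → q < 0ℚ → 0ℚ < p * q
  0<*-neg {p} {q} p<0 q<0 = positive⁻¹ (p * q) {{neg*neg⇒pos p {{negative p<0}} q {{negative q<0}}}}

  0≤sq : ∀ p → 0ℚ ≤ sq p
  0≤sq p with ≤-total 0ℚ p
  ... | inj₁ 0≤p = 0≤* 0≤p 0≤p
  ... | inj₂ p≤0 = 0≤*-nonPos p≤0 p≤0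

  0<3 : 0ℚ < 3ℚ
  0<3 = positive⁻¹ 3ℚ

  0≤-cancel-pos : ∀ {c p} → 0ℚ < c → 0ℚ ≤ c * p → 0ℚ ≤ p
  0≤-cancel-pos {c} {p} 0<c 0≤cp = *-cancelˡ-≤-pos c {{positive 0<c}} (subst (_≤ c * p) (sym (*-zeroʳ c)) 0≤cp)

  sq-mono-≤ : ∀ {p q} → 0ℚ ≤ p → p ≤ q → sq p ≤ sq q
  sq-mono-≤ {p} {q} 0≤p p≤q =
    ≤-trans (*-monoˡ-≤-nonNeg p {{nonNegative 0≤p}} p≤q) (*-monoʳ-≤-nonNeg q {{nonNegative (≤-trans 0≤p p≤q)}} p≤q)

  sq-cancel-≤ : ∀ {p q} → 0ℚ ≤ q → sq p ≤ sq q → p ≤ q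
  sq-cancel-≤ {p} {q} 0≤q p²≤q² with p ≤? q
  ... | yes p≤q = p≤q
  ... | no  p≰q = contradiction (≤-<-trans p²≤q² q²<p²) (<-irrefl refl)
    where
    q<p = ≰⇒> p≰q
    q²<p² : sq q < sq p
    q²<p² = ≤-<-trans (*-monoˡ-≤-nonNeg q {{nonNegative 0≤q}} (<⇒≤ q<p))
                      (*-monoˡ-<-pos p {{positive (≤-<-trans 0≤q q<p)}} q<p)

  ℚ² : Set
  ℚ² = ℚ × ℚ

  infixl 6 _−_
  infix 7 _∙_ _⊛_

  _−_ : ℚ² → ℚ² → ℚ²
  (a , b) − (c , d) = (a - c , b - d)

  _∙_ : ℚ² → ℚ² → ℚ
  (a , b) ∙ (c , d) = a * c + b * d

  _⊛_ : ℚ² → ℚ² → ℚ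
  (a , b) ⊛ (c , d) = a * d - b * c

  ∥_∥² : ℚ² → ℚ
  ∥ u ∥² = u ∙ u

  -- cos ∠(u , w) ≥ 1/2, i.e. ∥u∥ ∥w∥ ≤ 2 u ∙ w without square roots; it holds when u or w is zero.
  AngleAtMost60° : ℚ² → ℚ² → Set
  AngleAtMost60° u w = 0ℚ ≤ u ∙ w × ∥ u ∥² * ∥ w ∥² ≤ sq (u ∙ w + u ∙ w)

  ∥∥²-nonNeg : ∀ u → 0ℚ ≤ ∥ u ∥²
  ∥∥²-nonNeg (a , b) = 0≤+ (0≤sq a) (0≤sq b)

  ∙-comm : ∀ u w → u ∙ w ≡ w ∙ u
  ∙-comm (a , b) (c , d) = cong₂ _+_ (*-comm a c) (*-comm b d)

  lagrange-identity : ∀ u w → sq (u ∙ w) + sq (u ⊛ w) ≡ ∥ u ∥² * ∥ w ∥²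
  lagrange-identity (a , b) (c , d) = expanded
    where
    expanded : (a * c + b * d) * (a * c + b * d) + (a * d - b * c) * (a * d - b * c) ≡ (a * a + b * b) * (c * c + d * d)
    expanded = solve (a ∷ b ∷ c ∷ d ∷ []) ℚ-ring

  law-of-cosines : ∀ u w → ∥ u − w ∥² ≡ ∥ u ∥² + ∥ w ∥² - (u ∙ w + u ∙ w)
  law-of-cosines (a , b) (c , d) = expanded
    where
    expanded : (a - c) * (a - c) + (b - d) * (b - d) ≡ a * a + b * b + (c * c + d * d) - (a * c + b * d + (a * c + b * d))
    expanded = solve (a ∷ b ∷ c ∷ d ∷ []) ℚ-ring

  angle≤60°-sym : ∀ u w → AngleAtMost60° u w → AngleAtMost60° w u
  angle≤60°-sym u w (0≤u∙w , N≤P²) rewrite ∙-comm w u =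
    0≤u∙w , subst (_≤ sq (u ∙ w + u ∙ w)) (*-comm ∥ u ∥² ∥ w ∥²) N≤P²

  zero-angle≤60° : ∀ u w → ∥ u ∥² ≤ 0ℚ → AngleAtMost60° u w
  zero-angle≤60° u w ∥u∥²≤0 = 0≤u∙w , ≤-trans N≤0 (0≤sq (u ∙ w + u ∙ w))
    where
    N≤0 : ∥ u ∥² * ∥ w ∥² ≤ 0ℚ
    N≤0 = nonPositive⁻¹ (∥ u ∥² * ∥ w ∥²)
            {{nonPos*nonNeg⇒nonPos ∥ u ∥² {{nonPositive ∥u∥²≤0}} ∥ w ∥² {{nonNegative (∥∥²-nonNeg w)}}}}
    p²≤0 : sq (u ∙ w) ≤ 0ℚ
    p²≤0 = ≤-trans (≤-by-gap (sq (u ⊛ w)) (0≤sq (u ⊛ w)) refl) (subst (_≤ 0ℚ) (sym (lagrange-identity u w)) N≤0)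
    0≤u∙w : 0ℚ ≤ u ∙ w
    0≤u∙w with 0ℚ ≤? u ∙ w
    ... | yes 0≤p = 0≤p
    ... | no  0≰p = contradiction (<-≤-trans (0<*-neg (≰⇒> 0≰p) (≰⇒> 0≰p)) p²≤0) (<-irrefl refl)

  -- w rotated by the angle −arg u and scaled by ∥u∥.
  frame : ℚ² → ℚ² → ℚ²
  frame u w = (u ∙ w , u ⊛ w)

  frame-∙ : ∀ u v w → frame u v ∙ frame u w ≡ ∥ u ∥² * (v ∙ w)
  frame-∙ (a , b) (c , d) (e , f) = expanded
    where
    expanded : (a * c + b * d) * (a * e + b * f) + (a * d - b * c) * (a * f - b * e) ≡ (a * a + b * b) * (c * e + d * f)
    expanded = solve (a ∷ b ∷ c ∷ d ∷ e ∷ f ∷ []) ℚ-ring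

  frame-reflects-angle≤60° : ∀ u v w → 0ℚ < ∥ u ∥² → AngleAtMost60° (frame u v) (frame u w) → AngleAtMost60° v w
  frame-reflects-angle≤60° u v w 0<n (0≤F , M≤F²) =
    0≤-cancel-pos 0<n (subst (0ℚ ≤_) (frame-∙ u v w) 0≤F) ,
    *-cancelˡ-≤-pos (sq n) {{positive (0<* 0<n 0<n)}} (subst₂ _≤_ M≡n²N F²≡n²P² M≤F²)
    where
    n = ∥ u ∥²
    scale-product : ∀ n x y → n * x * (n * y) ≡ (n * n) * (x * y)
    scale-product n x y = solve (n ∷ x ∷ y ∷ []) ℚ-ring
    scale-double : ∀ n p → (n * p + n * p) * (n * p + n * p) ≡ (n * n) * ((p + p) * (p + p))
    scale-double n p = solve (n ∷ p ∷ []) ℚ-ring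
    M≡n²N : ∥ frame u v ∥² * ∥ frame u w ∥² ≡ sq n * (∥ v ∥² * ∥ w ∥²)
    M≡n²N = trans (cong₂ _*_ (frame-∙ u v v) (frame-∙ u w w)) (scale-product n ∥ v ∥² ∥ w ∥²)
    F²≡n²P² : sq (frame u v ∙ frame u w + frame u v ∙ frame u w) ≡ sq n * sq (v ∙ w + v ∙ w)
    F²≡n²P² = trans (cong (λ F → sq (F + F)) (frame-∙ u v w)) (scale-double n (v ∙ w))

  -- With X = a₁a₂, Y = b₁b₂ and p = X + Y:  3p = (Y + 3X) + 2Y  and
  -- 3 ((2p)² − (a₁² + b₁²)(a₂² + b₂²)) = (b₁² − 3a₁²)(b₂² − 3a₂²) + 8Y(Y + 3X).
  angle≤60°-criterion : ∀ a₁ b₁ a₂ b₂ → 0ℚ ≤ (sq b₁ - 3ℚ * sq a₁) * (sq b₂ - 3ℚ * sq a₂) →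
                        0ℚ ≤ b₁ * b₂ → 0ℚ ≤ b₁ * b₂ + 3ℚ * (a₁ * a₂) → AngleAtMost60° (a₁ , b₁) (a₂ , b₂)
  angle≤60°-criterion a₁ b₁ a₂ b₂ 0≤h₁h₂ 0≤Y 0≤Y+3X =
    0≤-cancel-pos 0<3 (subst (0ℚ ≤_) (three-dot a₁ b₁ a₂ b₂) (0≤+ 0≤Y+3X (0≤+ 0≤Y 0≤Y))) ,
    *-cancelˡ-≤-pos 3ℚ (≤-by-gap _ (0≤+ 0≤h₁h₂ (0≤* (0≤* (nonNegative⁻¹ 8ℚ) 0≤Y) 0≤Y+3X)) (three-excess a₁ b₁ a₂ b₂))
    where
    three-dot : ∀ a₁ b₁ a₂ b₂ → b₁ * b₂ + 3ℚ * (a₁ * a₂) + (b₁ * b₂ + b₁ * b₂) ≡ 3ℚ * (a₁ * a₂ + b₁ * b₂)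
    three-dot a₁ b₁ a₂ b₂ = solve (a₁ ∷ b₁ ∷ a₂ ∷ b₂ ∷ []) ℚ-ring
    three-excess : ∀ a₁ b₁ a₂ b₂ →
      3ℚ * ((a₁ * a₁ + b₁ * b₁) * (a₂ * a₂ + b₂ * b₂))
        + ((b₁ * b₁ - 3ℚ * (a₁ * a₁)) * (b₂ * b₂ - 3ℚ * (a₂ * a₂)) + 8ℚ * (b₁ * b₂) * (b₁ * b₂ + 3ℚ * (a₁ * a₂)))
      ≡ 3ℚ * ((a₁ * a₂ + b₁ * b₂ + (a₁ * a₂ + b₁ * b₂)) * (a₁ * a₂ + b₁ * b₂ + (a₁ * a₂ + b₁ * b₂)))
    three-excess a₁ b₁ a₂ b₂ = solve (a₁ ∷ b₁ ∷ a₂ ∷ b₂ ∷ []) ℚ-ring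

  steep-angle≤60° : ∀ a₁ b₁ a₂ b₂ → 0ℚ ≤ b₁ * b₂ → 3ℚ * sq a₁ ≤ sq b₁ → 3ℚ * sq a₂ ≤ sq b₂ →
                    AngleAtMost60° (a₁ , b₁) (a₂ , b₂)
  steep-angle≤60° a₁ b₁ a₂ b₂ 0≤Y s₁ s₂ =
    angle≤60°-criterion a₁ b₁ a₂ b₂ (0≤* 0≤h₁ 0≤h₂) 0≤Y (-p≤q⇒0≤q+p (sq-cancel-≤ 0≤Y 9X²≤Y²))
    where
    0≤h₁ = p≤q⇒0≤q-p s₁
    0≤h₂ = p≤q⇒0≤q-p s₂
    Y²-9X² : ∀ a₁ b₁ a₂ b₂ →
      (- (3ℚ * (a₁ * a₂))) * (- (3ℚ * (a₁ * a₂)))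
        + ((b₁ * b₁ - 3ℚ * (a₁ * a₁)) * (b₂ * b₂) + 3ℚ * (a₁ * a₁) * (b₂ * b₂ - 3ℚ * (a₂ * a₂)))
      ≡ (b₁ * b₂) * (b₁ * b₂)
    Y²-9X² a₁ b₁ a₂ b₂ = solve (a₁ ∷ b₁ ∷ a₂ ∷ b₂ ∷ []) ℚ-ring
    9X²≤Y² : sq (- (3ℚ * (a₁ * a₂))) ≤ sq (b₁ * b₂)
    9X²≤Y² = ≤-by-gap _ (0≤+ (0≤* 0≤h₁ (0≤sq b₂)) (0≤* (0≤* (<⇒≤ 0<3) (0≤sq a₁)) 0≤h₂)) (Y²-9X² a₁ b₁ a₂ b₂)

  flat-angle≤60° : ∀ a₁ b₁ a₂ b₂ → 0ℚ ≤ a₁ * a₂ → 0ℚ ≤ b₁ * b₂ → sq b₁ ≤ 3ℚ * sq a₁ → sq b₂ ≤ 3ℚ * sq a₂ →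
                   AngleAtMost60° (a₁ , b₁) (a₂ , b₂)
  flat-angle≤60° a₁ b₁ a₂ b₂ 0≤X 0≤Y f₁ f₂ =
    angle≤60°-criterion a₁ b₁ a₂ b₂ (0≤*-nonPos (p≤q⇒p-q≤0 f₁) (p≤q⇒p-q≤0 f₂)) 0≤Y (0≤+ 0≤Y (0≤* (<⇒≤ 0<3) 0≤X))

  -- Four sectors of width 60° covering the directions (60°, 300°):
  -- (60°, 120°), (240°, 300°), [120°, 180°] and (180°, 240°].
  Sector : Fin 4 → ℚ² → Set
  Sector 0F (a , b) = 0ℚ < b × 3ℚ * sq a < sq b
  Sector 1F (a , b) = b < 0ℚ × 3ℚ * sq a < sq b
  Sector 2F (a , b) = a < 0ℚ × 0ℚ ≤ b × sq b ≤ 3ℚ * sq a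
  Sector 3F (a , b) = a < 0ℚ × b < 0ℚ × sq b ≤ 3ℚ * sq a

  same-sector⇒angle≤60° : ∀ k v w → Sector k v → Sector k w → AngleAtMost60° v w
  same-sector⇒angle≤60° 0F (a₁ , b₁) (a₂ , b₂) (0<b₁ , s₁) (0<b₂ , s₂) =
    steep-angle≤60° a₁ b₁ a₂ b₂ (0≤* (<⇒≤ 0<b₁) (<⇒≤ 0<b₂)) (<⇒≤ s₁) (<⇒≤ s₂)
  same-sector⇒angle≤60° 1F (a₁ , b₁) (a₂ , b₂) (b₁<0 , s₁) (b₂<0 , s₂) =
    steep-angle≤60° a₁ b₁ a₂ b₂ (0≤*-nonPos (<⇒≤ b₁<0) (<⇒≤ b₂<0)) (<⇒≤ s₁) (<⇒≤ s₂)
  same-sector⇒angle≤60° 2F (a₁ , b₁) (a₂ , b₂) (a₁<0 , 0≤b₁ , f₁) (a₂<0 , 0≤b₂ , f₂) =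
    flat-angle≤60° a₁ b₁ a₂ b₂ (0≤*-nonPos (<⇒≤ a₁<0) (<⇒≤ a₂<0)) (0≤* 0≤b₁ 0≤b₂) f₁ f₂
  same-sector⇒angle≤60° 3F (a₁ , b₁) (a₂ , b₂) (a₁<0 , b₁<0 , f₁) (a₂<0 , b₂<0 , f₂) =
    flat-angle≤60° a₁ b₁ a₂ b₂ (0≤*-nonPos (<⇒≤ a₁<0) (<⇒≤ a₂<0)) (0≤*-nonPos (<⇒≤ b₁<0) (<⇒≤ b₂<0)) f₁ f₂

  sector-of : ∀ a b → a < 0ℚ ⊎ 3ℚ * sq a < sq b → ∃ λ k → Sector k (a , b)
  sector-of a b (inj₂ steep) with <-cmp 0ℚ b
  ... | tri< 0<b _ _ = 0F , 0<b , steep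
  ... | tri> _ _ b<0 = 1F , b<0 , steep
  ... | tri≈ _ refl _ = contradiction (≤-<-trans (0≤* (<⇒≤ 0<3) (0≤sq a)) steep) (<-irrefl refl)
  sector-of a b (inj₁ a<0) with 3ℚ * sq a <? sq b | 0ℚ ≤? b
  ... | yes steep | _       = sector-of a b (inj₂ steep)
  ... | no  flat  | yes 0≤b = 2F , a<0 , 0≤b , ≮⇒≥ flat
  ... | no  flat  | no  0≰b = 3F , a<0 , ≰⇒> 0≰b , ≮⇒≥ flat

  wide⇒obtuse⊎steep : ∀ u w → ¬ AngleAtMost60° u w → u ∙ w < 0ℚ ⊎ 3ℚ * sq (u ∙ w) < sq (u ⊛ w)
  wide⇒obtuse⊎steep u w wide with 0ℚ ≤? u ∙ w | 3ℚ * sq (u ∙ w) <? sq (u ⊛ w)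
  ... | no  0≰p | _          = inj₁ (≰⇒> 0≰p)
  ... | yes _   | yes steep  = inj₂ steep
  ... | yes 0≤p | no  ¬steep = contradiction (0≤p , N≤P²) wide
    where
    p = u ∙ w
    open ≤-Reasoning
    four-squares : ∀ p → p * p + 3ℚ * (p * p) ≡ (p + p) * (p + p)
    four-squares p = solve (p ∷ []) ℚ-ring
    N≤P² : ∥ u ∥² * ∥ w ∥² ≤ sq (p + p)
    N≤P² = begin
      ∥ u ∥² * ∥ w ∥²   ≡⟨ lagrange-identity u w ⟨
      sq p + sq (u ⊛ w)  ≤⟨ +-monoʳ-≤ (sq p) (≮⇒≥ ¬steep) ⟩
      sq p + 3ℚ * sq p   ≡⟨ four-squares p ⟩
      sq (p + p)         ∎

  wide⇒sector : ∀ u w → ¬ AngleAtMost60° u w → ∃ λ k → Sector k (frame u w)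
  wide⇒sector u w wide = sector-of (u ∙ w) (u ⊛ w) (wide⇒obtuse⊎steep u w wide)

  -- In the frame of u 0F the other five vectors fall into the four sectors, so two share one.
  six-vectors-not-pairwise-wide : (u : Fin 6 → ℚ²) → ¬ (∀ k l → k ≢ l → ¬ AngleAtMost60° (u k) (u l))
  six-vectors-not-pairwise-wide u wide with 0ℚ <? ∥ u 0F ∥²
  ... | no  ∥u₀∥²≯0 = wide 0F 1F (λ ()) (zero-angle≤60° (u 0F) (u 1F) (≮⇒≥ ∥u₀∥²≯0))
  ... | yes 0<∥u₀∥² = two-in-one-sector (pigeonhole (n<1+n 4) (proj₁ ∘ sector))
    where
    sector : ∀ k → ∃ λ s → Sector s (frame (u 0F) (u (suc k)))
    sector k = wide⇒sector (u 0F) (u (suc k)) (wide 0F (suc k) (λ ()))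
    two-in-one-sector : (∃₂ λ i j → i <ᶠ j × proj₁ (sector i) ≡ proj₁ (sector j)) → ⊥
    two-in-one-sector (i , j , i<j , same) =
      wide (suc i) (suc j) (<ᶠ⇒≢ i<j ∘ suc-injective)
        (frame-reflects-angle≤60° (u 0F) (u (suc i)) (u (suc j)) 0<∥u₀∥²
          (same-sector⇒angle≤60° _ (frame (u 0F) (u (suc i))) (frame (u 0F) (u (suc j)))
            (proj₂ (sector i)) (subst (λ s → Sector s (frame (u 0F) (u (suc j)))) (sym same) (proj₂ (sector j)))))

  centre : Disk → ℚ²
  centre D = (cx D , cy D)

  radius-nonNeg : ∀ D → 0ℚ ≤ r D
  radius-nonNeg (disk _ _ ρ) = <⇒≤ (positive⁻¹ ρ)

  ∥−∥²-comm : ∀ u w → ∥ u − w ∥² ≡ ∥ w − u ∥²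
  ∥−∥²-comm (a , b) (c , d) = expanded
    where
    expanded : (a - c) * (a - c) + (b - d) * (b - d) ≡ (c - a) * (c - a) + (d - b) * (d - b)
    expanded = solve (a ∷ b ∷ c ∷ d ∷ []) ℚ-ring

  intersect-sym : ∀ D E → Intersect D E → Intersect E D
  intersect-sym D E = subst₂ _≤_ (∥−∥²-comm (centre D) (centre E)) (cong sq (+-comm (r D) (r E)))

  third-side≤longer-side : ∀ u w → ∥ u ∥² ≤ ∥ w ∥² → AngleAtMost60° u w → ∥ u − w ∥² ≤ ∥ w ∥²
  third-side≤longer-side u w A≤B (0≤p , AB≤P²) = begin
    ∥ u − w ∥²      ≡⟨ law-of-cosines u w ⟩
    A + B - P       ≤⟨ ≤-by-gap (P - A) (p≤q⇒0≤q-p A≤P) (cancel A B P) ⟩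
    B               ∎
    where
    open ≤-Reasoning
    A = ∥ u ∥²
    B = ∥ w ∥²
    P = u ∙ w + u ∙ w
    A≤P : A ≤ P
    A≤P = sq-cancel-≤ (0≤+ 0≤p 0≤p) (≤-trans (*-monoˡ-≤-nonNeg A {{nonNegative (∥∥²-nonNeg u)}} A≤B) AB≤P²)
    cancel : ∀ A B P → A + B - P + (P - A) ≡ B
    cancel A B P = solve (A ∷ B ∷ P ∷ []) ℚ-ring

  centre-difference : ∀ d e f → (d − e) − (d − f) ≡ f − e
  centre-difference (a , b) (c , d) (e , f) = cong₂ _,_ (difference a c e) (difference b d f)
    where
    difference : ∀ a c e → a - c - (a - e) ≡ e - c
    difference a c e = solve (a ∷ c ∷ e ∷ []) ℚ-ring

  nearer-neighbour-meets : ∀ D E F → r D ≤ r E → Intersect D F →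
    ∥ centre D − centre E ∥² ≤ ∥ centre D − centre F ∥² → AngleAtMost60° (centre D − centre E) (centre D − centre F) →
    Intersect F E
  nearer-neighbour-meets D E F rD≤rE DF nearer angle = begin
    ∥ centre F − centre E ∥²
      ≡⟨ cong ∥_∥² (centre-difference (centre D) (centre E) (centre F)) ⟨
    ∥ (centre D − centre E) − (centre D − centre F) ∥²
      ≤⟨ third-side≤longer-side (centre D − centre E) (centre D − centre F) nearer angle ⟩
    ∥ centre D − centre F ∥²                          ≤⟨ DF ⟩
    sq (r D + r F)                                    ≤⟨ sq-mono-≤ (0≤+ (radius-nonNeg D) (radius-nonNeg F)) rD+rF≤rF+rE ⟩
    sq (r F + r E)                                    ∎
    where
    open ≤-Reasoning
    rD+rF≤rF+rE : r D + r F ≤ r F + r E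
    rD+rF≤rF+rE = subst (r D + r F ≤_) (+-comm (r E) (r F)) (+-monoˡ-≤ (r F) rD≤rE)

  disjoint-larger-neighbours-wide : ∀ D E F → r D ≤ r E → r D ≤ r F → Intersect D E → Intersect D F → ¬ Intersect E F →
    ¬ AngleAtMost60° (centre D − centre E) (centre D − centre F)
  disjoint-larger-neighbours-wide D E F rD≤rE rD≤rF DE DF ¬EF angle
    with ≤-total ∥ centre D − centre E ∥² ∥ centre D − centre F ∥²
  ... | inj₁ nearer = ¬EF (intersect-sym F E (nearer-neighbour-meets D E F rD≤rE DF nearer angle))
  ... | inj₂ nearer =
    ¬EF (nearer-neighbour-meets D F E rD≤rF DE nearer (angle≤60°-sym (centre D − centre E) (centre D − centre F) angle))

  no-six-disjoint-larger-neighbours : (D : Disk) (E : Fin 6 → Disk) → (∀ k → r D ≤ r (E k)) → (∀ k → Intersect D (E k)) →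
    (∀ k l → k ≢ l → ¬ Intersect (E k) (E l)) → ⊥
  no-six-disjoint-larger-neighbours D E larger meets disjoint =
    six-vectors-not-pairwise-wide (λ k → centre D − centre (E k))
      (λ k l k≢l → disjoint-larger-neighbours-wide D (E k) (E l) (larger k) (larger l) (meets k) (meets l) (disjoint k l k≢l))

module FiniteSums where
  open import Data.Nat using (ℕ; zero; suc; _+_; _*_; _≤_; z≤n; s≤s⁻¹)
  open import Data.Nat.Properties using (+-*-semiring; +-mono-≤; *-cancelˡ-≤; +-identityʳ; module ≤-Reasoning)
  open import Algebra.Properties.Semiring.Sum +-*-semiring using (sum-syntax; ∑-comm; ∑-distrib-+; sum-cong-≗; sum-replicate-zero)
  open import Data.Bool using (if_then_else_)
  open import Data.Fin using (Fin; zero; suc)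
  open import Data.Fin.Properties using (suc-injective)
  open import Data.Fin.Subset using (Subset; ∣_∣; inside; outside)
  open import Data.Fin.Subset.Properties using (_∈?_)
  open import Data.List using (allFin; tabulate; map)
  open import Data.List.Properties using (map-tabulate)
  import Data.Nat.ListAction as ListAction
  open import Data.Product using (_×_; _,_; ∃)
  open import Data.Vec using ([]; _∷_)
  import Data.Vec.Functional as Vector
  open import Function using (_∘_; id)
  open import Function.Definitions using (Injective)
  open import Relation.Binary.PropositionalEquality using (_≡_; refl; trans; cong)
  open import Relation.Nullary using (¬_; Dec; yes; no; does; contradiction)

  𝟙 : {P : Set} → Dec P → ℕ
  𝟙 P? = if does P? then 1 else 0

  𝟙-yes : ∀ {P : Set} (P? : Dec P) → P → 𝟙 P? ≡ 1
  𝟙-yes (yes _) _ = refl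
  𝟙-yes (no ¬p) p = contradiction p ¬p

  𝟙-no : ∀ {P : Set} (P? : Dec P) → ¬ P → 𝟙 P? ≡ 0
  𝟙-no (yes p) ¬p = contradiction p ¬p
  𝟙-no (no _)  _  = refl

  ∑-mono-≤ : ∀ {n} {f g : Fin n → ℕ} → (∀ i → f i ≤ g i) → ∑[ i < n ] f i ≤ ∑[ i < n ] g i
  ∑-mono-≤ {zero}  f≤g = z≤n
  ∑-mono-≤ {suc n} f≤g = +-mono-≤ (f≤g zero) (∑-mono-≤ (f≤g ∘ suc))

  ∑-zero : ∀ {n} {f : Fin n → ℕ} → (∀ i → f i ≡ 0) → ∑[ i < n ] f i ≡ 0
  ∑-zero {n} f≡0 = trans (sum-cong-≗ f≡0) (sum-replicate-zero n)

  sum-tabulate : ∀ n (f : Fin n → ℕ) → ListAction.sum (tabulate f) ≡ ∑[ i < n ] f i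
  sum-tabulate zero    f = refl
  sum-tabulate (suc n) f = cong (f zero +_) (sum-tabulate n (f ∘ suc))

  sum-map-allFin : ∀ n (f : Fin n → ℕ) → ListAction.sum (map f (allFin n)) ≡ ∑[ i < n ] f i
  sum-map-allFin n f = trans (cong ListAction.sum (map-tabulate id f)) (sum-tabulate n f)

  ∣p∣≡∑𝟙[∈p] : ∀ {n} (p : Subset n) → ∣ p ∣ ≡ ∑[ i < n ] 𝟙 (i ∈? p)
  ∣p∣≡∑𝟙[∈p] []            = refl
  ∣p∣≡∑𝟙[∈p] (inside  ∷ p) = cong suc (∣p∣≡∑𝟙[∈p] p)
  ∣p∣≡∑𝟙[∈p] (outside ∷ p) = ∣p∣≡∑𝟙[∈p] p

  distinct-witnesses : ∀ {n} {P : Fin n → Set} (P? : ∀ j → Dec (P j)) k → k ≤ ∑[ j < n ] 𝟙 (P? j) →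
                       ∃ λ (g : Fin k → Fin n) → Injective _≡_ _≡_ g × (∀ a → P (g a))
  distinct-witnesses P? zero _ = (λ ()) , (λ { {()} }) , (λ ())
  distinct-witnesses {suc n} {P} P? (suc k) k<count with P? zero
  ... | no  _  = let g , g-inj , P∘g = distinct-witnesses (P? ∘ suc) (suc k) k<count
                 in suc ∘ g , g-inj ∘ suc-injective , P∘g
  ... | yes P₀ = let g , g-inj , P∘g = distinct-witnesses (P? ∘ suc) k (s≤s⁻¹ k<count)
                 in zero Vector.∷ suc ∘ g , zero∷suc∘-injective g-inj , P-zero∷suc∘ P∘g
    where
    zero∷suc∘-injective : ∀ {g : Fin k → Fin n} → Injective _≡_ _≡_ g → Injective _≡_ _≡_ (zero Vector.∷ suc ∘ g)
    zero∷suc∘-injective g-inj {zero}  {zero}  _ = refl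
    zero∷suc∘-injective g-inj {suc a} {suc b} e = cong suc (g-inj (suc-injective e))
    P-zero∷suc∘ : ∀ {g : Fin k → Fin n} → (∀ a → P (suc (g a))) → ∀ a → P ((zero Vector.∷ suc ∘ g) a)
    P-zero∷suc∘ P∘g zero    = P₀
    P-zero∷suc∘ P∘g (suc a) = P∘g a

  ∑∑-≤-by-symmetrisation : ∀ {n} (e w : Fin n → Fin n → ℕ) → (∀ i j → e i j + e j i ≤ w i j + w j i) →
                           ∑[ i < n ] ∑[ j < n ] e i j ≤ ∑[ i < n ] ∑[ j < n ] w i j
  ∑∑-≤-by-symmetrisation {n} e w e≤w = *-cancelˡ-≤ 2 (begin
    2 * ∑∑ e                              ≡⟨ twice-∑∑ e ⟨
    ∑[ i < n ] ∑[ j < n ] (e i j + e j i) ≤⟨ ∑-mono-≤ (λ i → ∑-mono-≤ (e≤w i)) ⟩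
    ∑[ i < n ] ∑[ j < n ] (w i j + w j i) ≡⟨ twice-∑∑ w ⟩
    2 * ∑∑ w                              ∎)
    where
    open ≤-Reasoning
    ∑∑ : (Fin n → Fin n → ℕ) → ℕ
    ∑∑ f = ∑[ i < n ] ∑[ j < n ] f i j
    twice-∑∑ : ∀ f → ∑[ i < n ] ∑[ j < n ] (f i j + f j i) ≡ 2 * ∑∑ f
    twice-∑∑ f = begin-equality
      ∑[ i < n ] ∑[ j < n ] (f i j + f j i)            ≡⟨ sum-cong-≗ (λ i → ∑-distrib-+ (f i) (λ j → f j i)) ⟩
      ∑[ i < n ] (∑[ j < n ] f i j + ∑[ j < n ] f j i) ≡⟨ ∑-distrib-+ (λ i → ∑[ j < n ] f i j) (λ i → ∑[ j < n ] f j i) ⟩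
      ∑∑ f + ∑[ i < n ] ∑[ j < n ] f j i               ≡⟨ cong (∑∑ f +_) (∑-comm (λ j i → f j i)) ⟨
      ∑∑ f + ∑∑ f                                       ≡⟨ cong (∑∑ f +_) (+-identityʳ (∑∑ f)) ⟨
      2 * ∑∑ f                                          ∎

module Charging where
  open Geometry using (intersect-sym; no-six-disjoint-larger-neighbours)
  open FiniteSums using (𝟙; 𝟙-yes; 𝟙-no; ∑-zero; sum-map-allFin; distinct-witnesses)
  open import Data.Nat.Properties using (+-*-semiring; ≤-reflexive; ≤-trans; ≰⇒>; <-asym; <⇒≢; +-comm; m≤n+m; m≤m+n)
  open import Algebra.Properties.Semiring.Sum +-*-semiring using (sum-syntax; sum-cong-≗)
  open import Data.Fin using (Fin; toℕ; _≟_)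
  open import Data.Fin.Subset using (Subset; _∈_; _─_)
  open import Data.Fin.Subset.Properties using (_∈?_; x∈p∪q⁻; p─q⊆p)
  open import Data.Nat using (_+_; _*_; _≤_; _<_; _≤?_; _<?_; z≤n)
  open import Data.Product using (_×_; _,_; ∃; proj₁)
  import Data.Rational as ℚ
  import Data.Rational.Properties as ℚ
  open import Data.Sum using (_⊎_; inj₁; inj₂; [_,_]′)
  import Data.Sum as Sum
  open import Function using (_∘_; id)
  open import Function.Definitions using (Injective)
  open import Relation.Binary.PropositionalEquality using (_≡_; _≢_; refl; sym; trans; cong; cong₂; subst)
  open import Relation.Nullary using (¬_; Dec; yes; no; ¬?; contradiction)
  open import Relation.Nullary.Decidable using (_×-dec_)

  ∈△⇒∈⊎∈ : ∀ {n} {A B : Subset n} {i} → i ∈ A △ B → i ∈ A ⊎ i ∈ B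
  ∈△⇒∈⊎∈ {A = A} {B} i∈A△B = Sum.map (p─q⊆p A B) (p─q⊆p B A) (x∈p∪q⁻ (A ─ B) (B ─ A) i∈A△B)

  △-neighbours-independent : ∀ {n} (D : Fin n → Disk) {I₁ I₂ i} → Independent D I₁ → Independent D I₂ → i ∈ I₁ △ I₂ →
    ∃ λ J → Independent D J × (∀ {j} → j ∈ I₁ △ I₂ → Adj D i j → j ∈ J)
  △-neighbours-independent D {I₁} {I₂} {i} ind₁ ind₂ i∈X with ∈△⇒∈⊎∈ {A = I₁} i∈X
  ... | inj₁ i∈I₁ = I₂ , ind₂ , λ j∈X adj →
    [ (λ j∈I₁ → contradiction adj (ind₁ i _ i∈I₁ j∈I₁)) , id ]′ (∈△⇒∈⊎∈ {A = I₁} j∈X)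
  ... | inj₂ i∈I₂ = I₁ , ind₁ , λ j∈X adj →
    [ id , (λ j∈I₂ → contradiction adj (ind₂ i _ i∈I₂ j∈I₂)) ]′ (∈△⇒∈⊎∈ {A = I₁} j∈X)

  -- An edge between disks of equal radius is charged to both of its ends.
  Charged : ∀ {n} → (Fin n → Disk) → Subset n → Fin n → Fin n → Set
  Charged D X i j = i ∈ X × j ∈ X × Adj D i j × r (D i) ℚ.≤ r (D j)

  charged? : ∀ {n} (D : Fin n → Disk) X i j → Dec (Charged D X i j)
  charged? D X i j = i ∈? X ×-dec j ∈? X ×-dec (¬? (i ≟ j) ×-dec intersect? (D i) (D j)) ×-dec r (D i) ℚ.≤? r (D j)

  no-six-charged : ∀ {n} (D : Fin n → Disk) {I₁ I₂ i} → Independent D I₁ → Independent D I₂ → i ∈ I₁ △ I₂ →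
    (g : Fin 6 → Fin n) → Injective _≡_ _≡_ g → ¬ (∀ a → Charged D (I₁ △ I₂) i (g a))
  no-six-charged D {i = i} ind₁ ind₂ i∈X g g-inj charged =
    let J , ind-J , neighbours∈J = △-neighbours-independent D ind₁ ind₂ i∈X
        in-J a = let _ , g-a∈X , adj , _ = charged a in neighbours∈J g-a∈X adj
    in no-six-disjoint-larger-neighbours (D i) (D ∘ g)
         (λ a → let _ , _ , _ , rᵢ≤ = charged a in rᵢ≤)
         (λ a → let _ , _ , (_ , meet) , _ = charged a in meet)
         (λ a b a≢b meet → ind-J (g a) (g b) (in-J a) (in-J b) (a≢b ∘ g-inj , meet))

  charges≤5 : ∀ {n} (D : Fin n → Disk) {I₁ I₂} → Independent D I₁ → Independent D I₂ → ∀ i →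
    ∑[ j < n ] 𝟙 (charged? D (I₁ △ I₂) i j) ≤ 5 * 𝟙 (i ∈? I₁ △ I₂)
  charges≤5 {n} D {I₁} {I₂} ind₁ ind₂ i = bound (i ∈? X)
    where
    X = I₁ △ I₂
    charges = ∑[ j < n ] 𝟙 (charged? D X i j)
    bound : (i∈X? : Dec (i ∈ X)) → charges ≤ 5 * 𝟙 i∈X?
    bound (no i∉X) = ≤-reflexive (∑-zero (λ j → 𝟙-no (charged? D X i j) (i∉X ∘ proj₁)))
    bound (yes i∈X) with charges ≤? 5
    ... | yes ≤5 = ≤5
    ... | no  ≰5 = let g , g-inj , charged = distinct-witnesses (charged? D X i) 6 (≰⇒> ≰5)
                   in contradiction charged (no-six-charged D ind₁ ind₂ i∈X g g-inj)

  edgeInd-cases : ∀ {n} (D : Fin n → Disk) X i j →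
    edgeInd D X i j ≡ 0 ⊎ (edgeInd D X i j ≡ 1 × toℕ i < toℕ j × i ∈ X × j ∈ X × Intersect (D i) (D j))
  edgeInd-cases D X i j with toℕ i <? toℕ j | i ∈? X | j ∈? X | intersect? (D i) (D j)
  ... | yes i<j | yes i∈X | yes j∈X | yes meet = inj₂ (refl , i<j , i∈X , j∈X , meet)
  ... | yes _   | yes _   | yes _   | no  _    = inj₁ refl
  ... | yes _   | yes _   | no  _   | _        = inj₁ refl
  ... | yes _   | no  _   | _       | _        = inj₁ refl
  ... | no  _   | _       | _       | _        = inj₁ refl

  edge-charged-to-an-end : ∀ {n} (D : Fin n → Disk) X {i j} → i ≢ j → i ∈ X → j ∈ X → Intersect (D i) (D j) →
    1 ≤ 𝟙 (charged? D X i j) + 𝟙 (charged? D X j i)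
  edge-charged-to-an-end D X {i} {j} i≢j i∈X j∈X meet with r (D i) ℚ.≤? r (D j)
  ... | yes rᵢ≤rⱼ = ≤-trans (≤-reflexive (sym (𝟙-yes (charged? D X i j) (i∈X , j∈X , (i≢j , meet) , rᵢ≤rⱼ))))
                            (m≤m+n (𝟙 (charged? D X i j)) (𝟙 (charged? D X j i)))
  ... | no  rᵢ≰rⱼ = ≤-trans (≤-reflexive (sym (𝟙-yes (charged? D X j i) (j∈X , i∈X , (i≢j ∘ sym , meet′) , rⱼ≤rᵢ))))
                            (m≤n+m (𝟙 (charged? D X j i)) (𝟙 (charged? D X i j)))
    where
    meet′ = intersect-sym (D i) (D j) meet
    rⱼ≤rᵢ = ℚ.<⇒≤ (ℚ.≰⇒> rᵢ≰rⱼ)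

  edge-pair≤charge-pair : ∀ {n} (D : Fin n → Disk) X i j →
    edgeInd D X i j + edgeInd D X j i ≤ 𝟙 (charged? D X i j) + 𝟙 (charged? D X j i)
  edge-pair≤charge-pair D X i j with edgeInd-cases D X i j | edgeInd-cases D X j i
  ... | inj₁ eᵢⱼ≡0 | inj₁ eⱼᵢ≡0 = ≤-trans (≤-reflexive (cong₂ _+_ eᵢⱼ≡0 eⱼᵢ≡0)) z≤n
  ... | inj₂ (eᵢⱼ≡1 , i<j , i∈X , j∈X , meet) | inj₁ eⱼᵢ≡0 =
    ≤-trans (≤-reflexive (cong₂ _+_ eᵢⱼ≡1 eⱼᵢ≡0)) (edge-charged-to-an-end D X (<⇒≢ i<j ∘ cong toℕ) i∈X j∈X meet)
  ... | inj₁ eᵢⱼ≡0 | inj₂ (eⱼᵢ≡1 , j<i , j∈X , i∈X , meet) =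
    ≤-trans (≤-reflexive (cong₂ _+_ eᵢⱼ≡0 eⱼᵢ≡1))
      (subst (1 ≤_) (+-comm (𝟙 (charged? D X j i)) (𝟙 (charged? D X i j)))
        (edge-charged-to-an-end D X (<⇒≢ j<i ∘ cong toℕ) j∈X i∈X meet))
  ... | inj₂ (_ , i<j , _) | inj₂ (_ , j<i , _) = contradiction j<i (<-asym i<j)

  edgesInduced≡∑∑ : ∀ {n} (D : Fin n → Disk) X → edgesInduced D X ≡ ∑[ i < n ] ∑[ j < n ] edgeInd D X i j
  edgesInduced≡∑∑ {n} D X = trans (sum-map-allFin n _) (sum-cong-≗ (λ i → sum-map-allFin n (edgeInd D X i)))

open FiniteSums using (𝟙; ∑-mono-≤; ∣p∣≡∑𝟙[∈p]; ∑∑-≤-by-symmetrisation)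
open Charging using (charged?; charges≤5; edge-pair≤charge-pair; edgesInduced≡∑∑)
open import Data.Nat using (ℕ; _≤_; _*_)
open import Data.Nat.Properties using (+-*-semiring; module ≤-Reasoning)
open import Algebra.Properties.Semiring.Sum +-*-semiring using (sum-syntax; *-distribˡ-sum)
open import Data.Fin using (Fin)
open import Data.Fin.Subset using (Subset; ∣_∣)
open import Data.Fin.Subset.Properties using (_∈?_)
open import Data.Product using (_,_)
open import Data.Rational as ℚ using (ℚ; _<_; 0ℚ; _/_)
open import Data.Integer using (+_)
open import Relation.Binary.PropositionalEquality using (_≡_; cong)

lemma3p3 : (n : ℕ) (D : Fin n → Disk) (c : ℚ) → 0ℚ < c →
    (α : ℕ) → IndependenceNumber D α → (+ α) / 1 ≡ c ℚ.* ((+ n) / 1) →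
    (I₁ I₂ : Subset n) → MaximumIndependent D I₁ → MaximumIndependent D I₂ →
    edgesInduced D (I₁ △ I₂) ≤ 5 * ∣ I₁ △ I₂ ∣
lemma3p3 n D _ _ _ _ _ I₁ I₂ (ind₁ , _) (ind₂ , _) = begin
  edgesInduced D X                            ≡⟨ edgesInduced≡∑∑ D X ⟩
  ∑[ i < n ] ∑[ j < n ] edgeInd D X i j       ≤⟨ ∑∑-≤-by-symmetrisation (edgeInd D X) charges (edge-pair≤charge-pair D X) ⟩
  ∑[ i < n ] ∑[ j < n ] charges i j           ≤⟨ ∑-mono-≤ (charges≤5 D ind₁ ind₂) ⟩
  ∑[ i < n ] (5 * 𝟙 (i ∈? X))                 ≡⟨ *-distribˡ-sum 5 (λ i → 𝟙 (i ∈? X)) ⟨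
  5 * ∑[ i < n ] 𝟙 (i ∈? X)                   ≡⟨ cong (5 *_) (∣p∣≡∑𝟙[∈p] X) ⟨
  5 * ∣ X ∣                                   ∎
  where
  open ≤-Reasoning
  X = I₁ △ I₂
  charges : Fin n → Fin n → ℕ
  charges i j = 𝟙 (charged? D X i j)
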